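{- Let $G=(V_1\cup V_2,E)$, with $V_1\cap V_2=\emptyset$, be a design graph with parameters $(m,d,c)$, where $V_1,V_2$ are the two parts of the bipartition. Then the integers $\gamma_1=5m-2d-2$ and $\gamma_2=-m+2d-2$ are distance eigenvalues of $G$.
   Context: All graphs are finite, simple and undirected. A design graph with parameters $(m,d,c)$, $c\neq 0$, is a $d$-regular bipartite graph of order $2m$ (so each part has $m$ vertices) in which any two distinct vertices of the same part have exactly $c$ common neighbors; the complete bipartite graph $K_{n,n}$ is excluded by convention. The distance matrix $D(G)$ of a connected graph $G$ is the matrix indexed by $V(G)$ with $D_{uv}=d_G(u,v)$, the graph distance between $u$ and $v$. A distance eigenvalue of $G$ is an eigenvalue of $D(G)$. -}

module Defs where

open import Data.Nat using (ℕ; zero; suc)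
import Data.Nat as ℕ
open import Data.Integer using (ℤ; +_)
import Data.Integer as ℤ
open import Data.Rational using (ℚ; _/_; 0ℚ)
import Data.Rational as ℚ
open import Data.Bool using (Bool; true; false; _∧_; _∨_; if_then_else_)
open import Data.Fin using (Fin; _≟_)
import Data.Fin as Fin
open import Data.Product using (Σ; ∃; _×_; _,_)
open import Relation.Nullary using (¬_)
open import Relation.Nullary.Decidable using (⌊_⌋)
open import Relation.Binary.PropositionalEquality using (_≡_; _≢_)

sumℕ : ∀ {n} → (Fin n → ℕ) → ℕ
sumℕ {zero}  f = 0
sumℕ {suc n} f = f Fin.zero ℕ.+ sumℕ (λ i → f (Fin.suc i))

sumℚ : ∀ {n} → (Fin n → ℚ) → ℚ
sumℚ {zero}  f = 0ℚ
sumℚ {suc n} f = f Fin.zero ℚ.+ sumℚ (λ i → f (Fin.suc i))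

anyFin : ∀ {n} → (Fin n → Bool) → Bool
anyFin {zero}  f = false
anyFin {suc n} f = f Fin.zero ∨ anyFin (λ i → f (Fin.suc i))

count : ∀ {n} → (Fin n → Bool) → ℕ
count f = sumℕ (λ i → if f i then 1 else 0)

record Graph (n : ℕ) : Set where
  field
    adj     : Fin n → Fin n → Bool
    symm    : ∀ u v → adj u v ≡ adj v u
    irrefl  : ∀ u → adj u u ≡ false

open Graph public

reach : ∀ {n} → Graph n → ℕ → Fin n → Fin n → Bool
reach G zero    u v = ⌊ u ≟ v ⌋
reach G (suc k) u v = anyFin (λ w → adj G u w ∧ reach G k w v)

Connected : ∀ {n} → Graph n → Set
Connected {n} G = ∀ (u v : Fin n) → ∃ λ k → reach G k u v ≡ true

leastFrom : (ℕ → Bool) → ℕ → ℕ → ℕ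
leastFrom f k zero       = k
leastFrom f k (suc fuel) = if f k then k else leastFrom f (suc k) fuel

-- graph distance: length of a shortest walk (in a connected graph on n
-- vertices every distance is < n, so the search below finds it)
dist : ∀ {n} → Graph n → Fin n → Fin n → ℕ
dist {n} G u v = leastFrom (λ k → reach G k u v) 0 n

distMatrix : ∀ {n} → Graph n → Fin n → Fin n → ℚ
distMatrix G u v = (+ dist G u v) / 1

IsEigenvalue : ∀ {n} → (Fin n → Fin n → ℚ) → ℚ → Set
IsEigenvalue {n} M λ′ =
  Σ (Fin n → ℚ) λ x → (∃ λ i → x i ≢ 0ℚ) ×
    (∀ u → sumℚ (λ v → M u v ℚ.* x v) ≡ λ′ ℚ.* x u)

IsDistanceEigenvalue : ∀ {n} → Graph n → ℤ → Set
IsDistanceEigenvalue G γ = IsEigenvalue (distMatrix G) (γ / 1)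

degree : ∀ {n} → Graph n → Fin n → ℕ
degree G v = count (adj G v)

commonNeighbours : ∀ {n} → Graph n → Fin n → Fin n → ℕ
commonNeighbours G u v = count (λ w → adj G u w ∧ adj G v w)

-- G is a design graph with parameters (m,d,c) and bipartition given by
-- `part` (V₁ = part⁻¹ false, V₂ = part⁻¹ true).
record IsDesignGraph {n : ℕ} (G : Graph n) (part : Fin n → Bool) (m d c : ℕ) : Set where
  field
    bipartite   : ∀ u v → adj G u v ≡ true → part u ≢ part v
    size₁       : count (λ v → if part v then false else true) ≡ m
    size₂       : count part ≡ m
    regular     : ∀ v → degree G v ≡ d
    design      : ∀ u v → u ≢ v → part u ≡ part v → commonNeighbours G u v ≡ c
    c≢0         : c ≢ 0
    notComplete : ¬ (∀ u v → part u ≢ part v → adj G u v ≡ true)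

{-# OPTIONS --safe #-}
-- In a connected design graph only four distances occur: 0 on the diagonal, 2 between distinct
-- vertices of one part (they have c ≠ 0 common neighbours), 1 along edges, and 3 between
-- non-adjacent vertices of different parts (walk to a neighbour, then use a common neighbour).
-- So D = 2(J_same − I) + 3 J_cross − 2A, and on a vector equal to s on the part of u and o on the
-- other part, row u of D sums to (2m − 2) s + (3m − 2d) o: the bipartition is equitable for D.
-- Taking o = s gives the eigenvalue 5m − 2d − 2 (all-ones vector), and o = −s gives 2d − m − 2
-- (the vector ±1 according to the part).
module Submission where

open import Defs
open import Data.Nat using (ℕ; _*_)
open import Data.Integer using (+_; _-_)
open import Data.Fin using (Fin)
open import Data.Bool using (Bool)
open import Data.Product using (_×_)

open import Data.Bool using (true; false; not; _∧_; _xor_; if_then_else_)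
open import Data.Bool.Properties
  using (¬-not; not-involutive; not-distribˡ-xor; not-distribʳ-xor; xor-same;
         ∧-conicalˡ; ∧-conicalʳ; if-eta)
open import Data.Fin as Fin using (_≟_)
open import Data.Fin.Properties using (injective⇒≤)
open import Data.Integer as ℤ using (ℤ)
import Data.Integer.Properties as ℤP
open import Data.Integer.Tactic.RingSolver using (solve-∀)
open import Data.Nat as ℕ using (zero; suc; _≤_; _<_; z≤n; s≤s)
open import Data.Product using (∃; _,_)
open import Data.Rational as ℚ using (ℚ; toℚᵘ)
import Data.Rational.Properties as ℚP
open import Data.Rational.Unnormalised as ℚᵘ using (mkℚᵘ; *≡*; _≃_)
import Data.Rational.Unnormalised.Properties as ℚᵘP
open import Data.Vec using (Vec; lookup; []; _∷_)
open import Data.Vec.Relation.Unary.All using ([]; _∷_)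
open import Data.Vec.Relation.Unary.AllPairs using ([]; _∷_)
open import Data.Vec.Relation.Unary.Unique.Propositional using (Unique)
open import Data.Vec.Relation.Unary.Unique.Propositional.Properties using (lookup-injective)
open import Function using (_∘_)
open import Relation.Nullary using (¬_; yes; no; contradiction)
open import Relation.Nullary.Decidable using (⌊_⌋; isYes≗does; dec-true)
open import Relation.Binary.PropositionalEquality
open import Algebra.Properties.Semiring.Sum ℤP.+-*-semiring
  using (sum; sum-cong-≗; ∑-distrib-+; *-distribˡ-sum; *-distribʳ-sum)

count-cong : ∀ {n} {f g : Fin n → Bool} → (∀ i → f i ≡ g i) → count f ≡ count g
count-cong {zero}  f≗g = refl
count-cong {suc n} f≗g rewrite f≗g Fin.zero = cong (_ ℕ.+_) (count-cong (f≗g ∘ Fin.suc))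

count-false : ∀ n → count {n} (λ _ → false) ≡ 0
count-false zero    = refl
count-false (suc n) = count-false n

count-≟ : ∀ {n} (u : Fin n) → count (λ v → ⌊ u ≟ v ⌋) ≡ 1
count-≟ {suc n} Fin.zero    = cong suc (count-false n)
count-≟ {suc n} (Fin.suc u) = trans (count-cong suc-≟) (count-≟ u)
  where
  suc-≟ : ∀ v → ⌊ Fin.suc u ≟ Fin.suc v ⌋ ≡ ⌊ u ≟ v ⌋
  suc-≟ v with u ≟ v
  ... | yes _ = refl
  ... | no  _ = refl

count≢0⇒∃ : ∀ {n} (f : Fin n → Bool) → count f ≢ 0 → ∃ λ i → f i ≡ true
count≢0⇒∃ {zero}  f count≢0 = contradiction refl count≢0
count≢0⇒∃ {suc n} f count≢0 with f Fin.zero in f0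
... | true  = Fin.zero , f0
... | false with i , fi ← count≢0⇒∃ (f ∘ Fin.suc) count≢0 = Fin.suc i , fi

anyFin⇒∃ : ∀ {n} (f : Fin n → Bool) → anyFin f ≡ true → ∃ λ i → f i ≡ true
anyFin⇒∃ {suc n} f any with f Fin.zero in f0
... | true  = Fin.zero , f0
... | false with i , fi ← anyFin⇒∃ (f ∘ Fin.suc) any = Fin.suc i , fi

∃⇒anyFin : ∀ {n} (f : Fin n → Bool) {i} → f i ≡ true → anyFin f ≡ true
∃⇒anyFin f {Fin.zero}  fi rewrite fi = refl
∃⇒anyFin f {Fin.suc i} fi with f Fin.zero
... | true  = refl
... | false = ∃⇒anyFin (f ∘ Fin.suc) fi

distinct⇒≤ : ∀ {k n} {xs : Vec (Fin n) k} → Unique xs → k ≤ n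
distinct⇒≤ {xs = xs} xs! = injective⇒≤ {f = lookup xs} (lookup-injective xs! _ _)

¬∀⇒Fin : ∀ {n p} {P : Fin n → Set p} → ¬ (∀ i → P i) → Fin n
¬∀⇒Fin {zero}  ¬∀ = contradiction (λ ()) ¬∀
¬∀⇒Fin {suc n} _  = Fin.zero

𝟙 : Bool → ℤ
𝟙 b = + (if b then 1 else 0)

sum-𝟙 : ∀ {n} (f : Fin n → Bool) → sum (𝟙 ∘ f) ≡ + count f
sum-𝟙 {zero}  f = refl
sum-𝟙 {suc n} f = trans (cong (λ s → 𝟙 (f Fin.zero) ℤ.+ s) (sum-𝟙 (f ∘ Fin.suc)))
                        (sym (ℤP.pos-+ (if f Fin.zero then 1 else 0) _))

sum-𝟙-combination : ∀ {n} α β (f g : Fin n → Bool) →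
  sum (λ v → α ℤ.* 𝟙 (f v) ℤ.+ β ℤ.* 𝟙 (g v)) ≡ α ℤ.* + count f ℤ.+ β ℤ.* + count g
sum-𝟙-combination α β f g =
  trans (∑-distrib-+ (λ v → α ℤ.* 𝟙 (f v)) (λ v → β ℤ.* 𝟙 (g v)))
        (cong₂ ℤ._+_ (sum-scaled α f) (sum-scaled β g))
  where
  sum-scaled : ∀ α f → sum (λ v → α ℤ.* 𝟙 (f v)) ≡ α ℤ.* + count f
  sum-scaled α f = trans (sym (*-distribˡ-sum α (𝟙 ∘ f))) (cong (α ℤ.*_) (sum-𝟙 f))

sum-linear : ∀ {n} (x y : Fin n → ℤ) s t →
  sum (λ v → x v ℤ.* s ℤ.+ y v ℤ.* t) ≡ sum x ℤ.* s ℤ.+ sum y ℤ.* t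
sum-linear x y s t = trans (∑-distrib-+ (λ v → x v ℤ.* s) (λ v → y v ℤ.* t))
  (sym (cong₂ ℤ._+_ (*-distribʳ-sum s x) (*-distribʳ-sum t y)))

-- Integer eigenvectors of integer matrices

fromℤ : ℤ → ℚ
fromℤ i = i ℚ./ 1

toℚᵘ-fromℤ : ∀ i → toℚᵘ (fromℤ i) ≃ mkℚᵘ i 0
toℚᵘ-fromℤ i = ℚP.toℚᵘ-fromℚᵘ (mkℚᵘ i 0)

fromℤ-homo-+ : ∀ a b → fromℤ (a ℤ.+ b) ≡ fromℤ a ℚ.+ fromℤ b
fromℤ-homo-+ a b = ℚP.toℚᵘ-injective (begin
  toℚᵘ (fromℤ (a ℤ.+ b))              ≈⟨ toℚᵘ-fromℤ (a ℤ.+ b) ⟩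
  mkℚᵘ (a ℤ.+ b) 0                    ≈⟨ *≡* (unit-denominators a b) ⟩
  mkℚᵘ a 0 ℚᵘ.+ mkℚᵘ b 0              ≈⟨ ℚᵘP.+-cong (toℚᵘ-fromℤ a) (toℚᵘ-fromℤ b) ⟨
  toℚᵘ (fromℤ a) ℚᵘ.+ toℚᵘ (fromℤ b)  ≈⟨ ℚP.toℚᵘ-homo-+ (fromℤ a) (fromℤ b) ⟨
  toℚᵘ (fromℤ a ℚ.+ fromℤ b)          ∎)
  where
  open ℚᵘP.≃-Reasoning
  unit-denominators : ∀ a b → (a ℤ.+ b) ℤ.* + 1 ≡ (a ℤ.* + 1 ℤ.+ b ℤ.* + 1) ℤ.* + 1
  unit-denominators = solve-∀

fromℤ-homo-* : ∀ a b → fromℤ (a ℤ.* b) ≡ fromℤ a ℚ.* fromℤ b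
fromℤ-homo-* a b = ℚP.toℚᵘ-injective (begin
  toℚᵘ (fromℤ (a ℤ.* b))              ≈⟨ toℚᵘ-fromℤ (a ℤ.* b) ⟩
  mkℚᵘ (a ℤ.* b) 0                    ≈⟨ ℚᵘP.*-cong (toℚᵘ-fromℤ a) (toℚᵘ-fromℤ b) ⟨
  toℚᵘ (fromℤ a) ℚᵘ.* toℚᵘ (fromℤ b)  ≈⟨ ℚP.toℚᵘ-homo-* (fromℤ a) (fromℤ b) ⟨
  toℚᵘ (fromℤ a ℚ.* fromℤ b)          ∎)
  where open ℚᵘP.≃-Reasoning

fromℤ-injective : ∀ {a b} → fromℤ a ≡ fromℤ b → a ≡ b
fromℤ-injective {a} {b} eq = numerators (begin
  mkℚᵘ a 0        ≈⟨ toℚᵘ-fromℤ a ⟨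
  toℚᵘ (fromℤ a)  ≡⟨ cong toℚᵘ eq ⟩
  toℚᵘ (fromℤ b)  ≈⟨ toℚᵘ-fromℤ b ⟩
  mkℚᵘ b 0        ∎)
  where
  open ℚᵘP.≃-Reasoning
  numerators : mkℚᵘ a 0 ≃ mkℚᵘ b 0 → a ≡ b
  numerators (*≡* a*1≡b*1) = trans (sym (ℤP.*-identityʳ a)) (trans a*1≡b*1 (ℤP.*-identityʳ b))

sumℚ-cong : ∀ {n} {f g : Fin n → ℚ} → (∀ i → f i ≡ g i) → sumℚ f ≡ sumℚ g
sumℚ-cong {zero}  f≗g = refl
sumℚ-cong {suc n} f≗g = cong₂ ℚ._+_ (f≗g Fin.zero) (sumℚ-cong (f≗g ∘ Fin.suc))

sumℚ-fromℤ : ∀ {n} (f : Fin n → ℤ) → sumℚ (fromℤ ∘ f) ≡ fromℤ (sum f)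
sumℚ-fromℤ {zero}  f = refl
sumℚ-fromℤ {suc n} f = trans (cong (fromℤ (f Fin.zero) ℚ.+_) (sumℚ-fromℤ (f ∘ Fin.suc)))
                             (sym (fromℤ-homo-+ (f Fin.zero) _))

integer-eigenvector : ∀ {n} (M : Fin n → Fin n → ℤ) γ (x : Fin n → ℤ) →
  (∃ λ i → x i ≢ + 0) → (∀ u → sum (λ v → M u v ℤ.* x v) ≡ γ ℤ.* x u) →
  IsEigenvalue (λ u v → fromℤ (M u v)) (fromℤ γ)
integer-eigenvector M γ x (i , xi≢0) Mx≡γx =
  fromℤ ∘ x , (i , xi≢0 ∘ fromℤ-injective) , λ u → begin
    sumℚ (λ v → fromℤ (M u v) ℚ.* fromℤ (x v))  ≡⟨ sumℚ-cong (λ v → fromℤ-homo-* (M u v) (x v)) ⟨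
    sumℚ (λ v → fromℤ (M u v ℤ.* x v))          ≡⟨ sumℚ-fromℤ (λ v → M u v ℤ.* x v) ⟩
    fromℤ (sum (λ v → M u v ℤ.* x v))           ≡⟨ cong fromℤ (Mx≡γx u) ⟩
    fromℤ (γ ℤ.* x u)                           ≡⟨ fromℤ-homo-* γ (x u) ⟩
    fromℤ γ ℚ.* fromℤ (x u)                     ∎
  where open ≡-Reasoning

-- Walks and distances

leastFrom-suc : ∀ f s fuel → leastFrom f (suc s) fuel ≡ suc (leastFrom (f ∘ suc) s fuel)
leastFrom-suc f s zero       = refl
leastFrom-suc f s (suc fuel) with f (suc s)
... | true  = refl
... | false = leastFrom-suc f (suc s) fuel

leastFrom-first : ∀ f {k fuel} → k < fuel → f k ≡ true →
                  (∀ {j} → j < k → f j ≢ true) → leastFrom f 0 fuel ≡ k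
leastFrom-first f {zero}  {suc fuel} _ f0 _ rewrite f0 = refl
leastFrom-first f {suc k} {suc fuel} (s≤s k<fuel) fk earlier
  rewrite ¬-not (earlier {0} (s≤s z≤n)) | leastFrom-suc f 0 fuel =
  cong suc (leastFrom-first (f ∘ suc) k<fuel fk (earlier ∘ s≤s))

module _ {n} (G : Graph n) where

  adj⇒≢ : ∀ {u v} → adj G u v ≡ true → u ≢ v
  adj⇒≢ {u} uv refl = contradiction (trans (sym uv) (irrefl G u)) λ ()

  adj-sym : ∀ {u v} → adj G u v ≡ true → adj G v u ≡ true
  adj-sym {u} {v} uv = trans (symm G v u) uv

  adj-separates : ∀ {u v w} → adj G u w ≡ true → adj G u v ≡ false → w ≢ v
  adj-separates uw ¬uv refl = contradiction (trans (sym uw) ¬uv) λ ()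

  reach-0-refl : ∀ u → reach G 0 u u ≡ true
  reach-0-refl u = trans (isYes≗does (u ≟ u)) (dec-true (u ≟ u) refl)

  reach-0⇒≡ : ∀ {u v} → reach G 0 u v ≡ true → u ≡ v
  reach-0⇒≡ {u} {v} r with u ≟ v
  ... | yes u≡v = u≡v

  reach-suc⁺ : ∀ k {u w v} → adj G u w ≡ true → reach G k w v ≡ true → reach G (suc k) u v ≡ true
  reach-suc⁺ k {u} {w} {v} uw wv =
    ∃⇒anyFin (λ x → adj G u x ∧ reach G k x v) (cong₂ _∧_ uw wv)

  reach-suc⁻ : ∀ {k u v} → reach G (suc k) u v ≡ true →
               ∃ λ w → adj G u w ≡ true × reach G k w v ≡ true
  reach-suc⁻ {k} {u} {v} r with w , uwv ← anyFin⇒∃ (λ x → adj G u x ∧ reach G k x v) r =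
    w , ∧-conicalˡ _ _ uwv , ∧-conicalʳ _ _ uwv

  adj⇒reach-1 : ∀ {u v} → adj G u v ≡ true → reach G 1 u v ≡ true
  adj⇒reach-1 {u} {v} uv = reach-suc⁺ 0 uv (reach-0-refl v)

  reach-1⇒adj : ∀ {u v} → reach G 1 u v ≡ true → adj G u v ≡ true
  reach-1⇒adj {u} {v} r with w , uw , wv ← reach-suc⁻ {0} {u} {v} r
                        with refl ← reach-0⇒≡ {w} {v} wv = uw

  connected⇒neighbour : Connected G → ∀ {u v} → u ≢ v → ∃ λ w → adj G u w ≡ true
  connected⇒neighbour conn {u} {v} u≢v with conn u v
  ... | zero  , r = contradiction (reach-0⇒≡ {u} {v} r) u≢v
  ... | suc k , r with w , uw , _ ← reach-suc⁻ {k} {u} {v} r = w , uw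

  -- dist only searches lengths below n, so each use below exhibits k + 1 distinct vertices.
  dist-shortest : ∀ k {u v} → reach G k u v ≡ true → (∀ {j} → j < k → reach G j u v ≢ true) →
                  k < n → dist G u v ≡ k
  dist-shortest k {u} {v} r shorter k<n = leastFrom-first (λ j → reach G j u v) k<n r shorter

parity : ℕ → Bool
parity zero    = false
parity (suc k) = not (parity k)

module _ {n} (G : Graph n) (part : Fin n → Bool)
         (bipartite : ∀ u v → adj G u v ≡ true → part u ≢ part v) where

  reach⇒parity : ∀ k {u v} → reach G k u v ≡ true → part v ≡ parity k xor part u
  reach⇒parity zero    {u} {v} r = cong part (sym (reach-0⇒≡ G {u} {v} r))
  reach⇒parity (suc k) {u} {v} r with w , uw , wv ← reach-suc⁻ G {k} {u} {v} r = begin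
    part v                     ≡⟨ reach⇒parity k wv ⟩
    parity k xor part w        ≡⟨ cong (parity k xor_) (¬-not (bipartite u w uw ∘ sym)) ⟩
    parity k xor not (part u)  ≡⟨ not-distribʳ-xor (parity k) (part u) ⟨
    not (parity k xor part u)  ≡⟨ not-distribˡ-xor (parity k) (part u) ⟩
    not (parity k) xor part u  ∎
    where open ≡-Reasoning

  adj-opposite-side : ∀ {u v w} → adj G u w ≡ true → part u ≢ part v → part w ≡ part v
  adj-opposite-side {u} {v} {w} uw pu≢pv =
    trans (¬-not (bipartite u w uw ∘ sym)) (sym (¬-not (pu≢pv ∘ sym)))

-- The distance matrix of a design graph

xor≡false⇒≡ : ∀ {x y} → x xor y ≡ false → x ≡ y
xor≡false⇒≡ {false} {false} _ = refl
xor≡false⇒≡ {true}  {true}  _ = refl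

xor≡true⇒≢ : ∀ {x y} → x xor y ≡ true → x ≢ y
xor≡true⇒≢ {false} {true}  _ ()
xor≡true⇒≢ {true}  {false} _ ()

≢⇒xor≡true : ∀ {x y} → x ≢ y → x xor y ≡ true
≢⇒xor≡true {false} {false} x≢y = contradiction refl x≢y
≢⇒xor≡true {false} {true}  _   = refl
≢⇒xor≡true {true}  {false} _   = refl
≢⇒xor≡true {true}  {true}  x≢y = contradiction refl x≢y

-- PairType k e x a: the possible values of dist u v, [u = v], [u, v in different parts], [u ~ v].
data PairType : ℕ → Bool → Bool → Bool → Set where
  equal    : PairType 0 true  false false
  sameSide : PairType 2 false false false
  adjacent : PairType 1 false true  true
  farSide  : PairType 3 false true  false

ownPart-term : ∀ k s o → k ℤ.* s ≡ k ℤ.* s ℤ.+ + 0 ℤ.* o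
ownPart-term = solve-∀

otherPart-term : ∀ k s o → k ℤ.* o ≡ + 0 ℤ.* s ℤ.+ k ℤ.* o
otherPart-term = solve-∀

pairType-entry : ∀ {k e x a} → PairType k e x a → ∀ s o →
  + k ℤ.* (if x then o else s) ≡
  (+ 2 ℤ.* 𝟙 (not x) ℤ.+ ℤ.- + 2 ℤ.* 𝟙 e) ℤ.* s ℤ.+ (+ 3 ℤ.* 𝟙 x ℤ.+ ℤ.- + 2 ℤ.* 𝟙 a) ℤ.* o
pairType-entry equal    = ownPart-term (+ 0)
pairType-entry sameSide = ownPart-term (+ 2)
pairType-entry adjacent = otherPart-term (+ 1)
pairType-entry farSide  = otherPart-term (+ 3)

signOf : Bool → ℤ
signOf false = + 1
signOf true  = ℤ.- + 1

module DesignGraph {n} {G : Graph n} {part : Fin n → Bool} {m d c : ℕ}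
                   (DG : IsDesignGraph G part m d c) (conn : Connected G) where
  open IsDesignGraph DG

  cross : Fin n → Fin n → Bool
  cross u v = part u xor part v

  common-neighbour : ∀ {u v} → u ≢ v → part u ≡ part v →
                     ∃ λ w → adj G u w ≡ true × adj G v w ≡ true
  common-neighbour {u} {v} u≢v pu≡pv
    with w , uvw ← count≢0⇒∃ (λ w → adj G u w ∧ adj G v w)
                     (c≢0 ∘ trans (sym (design u v u≢v pu≡pv)))
    = w , ∧-conicalˡ _ _ uvw , ∧-conicalʳ _ _ uvw

  farSide-walk : ∀ {u v} → part u ≢ part v → adj G u v ≡ false →
    ∃ λ w → ∃ λ x → adj G u w ≡ true × adj G w x ≡ true × adj G x v ≡ true × u ≢ x × w ≢ v
  farSide-walk {u} {v} pu≢pv ¬uv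
    with w , uw ← connected⇒neighbour G conn (pu≢pv ∘ cong part)
    with x , wx , vx ← common-neighbour (adj-separates G uw ¬uv)
                                        (adj-opposite-side G part bipartite uw pu≢pv)
    = w , x , uw , wx , adj-sym G vx
    , adj-separates G vx (trans (symm G v u) ¬uv) ∘ sym , adj-separates G uw ¬uv

  dist-equal : ∀ u → dist G u u ≡ 0
  dist-equal u = dist-shortest G 0 (reach-0-refl G u) (λ ()) (distinct⇒≤ {xs = u ∷ []} ([] ∷ []))

  dist-adjacent : ∀ {u v} → adj G u v ≡ true → dist G u v ≡ 1
  dist-adjacent {u} {v} uv =
    dist-shortest G 1 (adj⇒reach-1 G uv) shorter (distinct⇒≤ ((u≢v ∷ []) ∷ [] ∷ []))
    where
    u≢v : u ≢ v
    u≢v = adj⇒≢ G uv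
    shorter : ∀ {j} → j < 1 → reach G j u v ≢ true
    shorter {0}     _ = u≢v ∘ reach-0⇒≡ G {u} {v}
    shorter {suc _} (s≤s ())

  dist-sameSide : ∀ {u v} → u ≢ v → part u ≡ part v → dist G u v ≡ 2
  dist-sameSide {u} {v} u≢v pu≡pv with w , uw , vw ← common-neighbour u≢v pu≡pv =
    dist-shortest G 2 (reach-suc⁺ G 1 uw (adj⇒reach-1 G (adj-sym G vw))) shorter
      (distinct⇒≤ ((u≢v ∷ adj⇒≢ G uw ∷ []) ∷ (adj⇒≢ G vw ∷ []) ∷ [] ∷ []))
    where
    shorter : ∀ {j} → j < 2 → reach G j u v ≢ true
    shorter {0} _ = u≢v ∘ reach-0⇒≡ G {u} {v}
    shorter {1} _ = (λ uv → bipartite u v uv pu≡pv) ∘ reach-1⇒adj G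
    shorter {suc (suc _)} (s≤s (s≤s ()))

  dist-farSide : ∀ {u v} → part u ≢ part v → adj G u v ≡ false → dist G u v ≡ 3
  dist-farSide {u} {v} pu≢pv ¬uv with w , x , uw , wx , xv , u≢x , w≢v ← farSide-walk pu≢pv ¬uv =
    dist-shortest G 3 (reach-suc⁺ G 2 uw (reach-suc⁺ G 1 wx (adj⇒reach-1 G xv))) shorter
      (distinct⇒≤ ( (adj⇒≢ G uw ∷ u≢x ∷ u≢v ∷ [])
                  ∷ (adj⇒≢ G wx ∷ w≢v ∷ [])
                  ∷ (adj⇒≢ G xv ∷ [])
                  ∷ [] ∷ []))
    where
    u≢v : u ≢ v
    u≢v = pu≢pv ∘ cong part
    shorter : ∀ {j} → j < 3 → reach G j u v ≢ true
    shorter {0} _   = u≢v ∘ reach-0⇒≡ G {u} {v}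
    shorter {1} _ r = contradiction (trans (sym (reach-1⇒adj G r)) ¬uv) λ ()
    shorter {2} _   = pu≢pv ∘ sym ∘ reach⇒parity G part bipartite 2
    shorter {suc (suc (suc _))} (s≤s (s≤s (s≤s ())))

  pairType : ∀ u v → PairType (dist G u v) ⌊ u ≟ v ⌋ (cross u v) (adj G u v)
  pairType u v with u ≟ v
  ... | yes refl rewrite dist-equal u | xor-same (part u) | irrefl G u = equal
  ... | no u≢v with adj G u v in uv
  ...   | true rewrite dist-adjacent uv | ≢⇒xor≡true (bipartite u v uv) = adjacent
  ...   | false with cross u v in x
  ...     | false rewrite dist-sameSide u≢v (xor≡false⇒≡ x) = sameSide
  ...     | true  rewrite dist-farSide (xor≡true⇒≢ x) uv = farSide

  count-not-part : count (not ∘ part) ≡ m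
  count-not-part = trans (count-cong (not-as-if ∘ part)) size₁
    where
    not-as-if : ∀ b → not b ≡ (if b then false else true)
    not-as-if false = refl
    not-as-if true  = refl

  count-cross : ∀ u → count (cross u) ≡ m
  count-cross u with part u
  ... | false = size₂
  ... | true  = count-not-part

  count-not-cross : ∀ u → count (not ∘ cross u) ≡ m
  count-not-cross u with part u
  ... | false = count-not-part
  ... | true  = trans (count-cong (not-involutive ∘ part)) size₂

  row-sum : ∀ u s o →
    sum (λ v → + dist G u v ℤ.* (if cross u v then o else s)) ≡
    (+ 2 ℤ.* + m ℤ.- + 2) ℤ.* s ℤ.+ (+ 3 ℤ.* + m ℤ.- + 2 ℤ.* + d) ℤ.* o
  row-sum u s o = begin
    sum (λ v → + dist G u v ℤ.* (if cross u v then o else s))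
      ≡⟨ sum-cong-≗ (λ v → pairType-entry (pairType u v) s o) ⟩
    sum (λ v → own v ℤ.* s ℤ.+ other v ℤ.* o)
      ≡⟨ sum-linear own other s o ⟩
    sum own ℤ.* s ℤ.+ sum other ℤ.* o
      ≡⟨ cong₂ (λ a b → a ℤ.* s ℤ.+ b ℤ.* o) sum-own sum-other ⟩
    (+ 2 ℤ.* + m ℤ.- + 2) ℤ.* s ℤ.+ (+ 3 ℤ.* + m ℤ.- + 2 ℤ.* + d) ℤ.* o
      ∎
    where
    open ≡-Reasoning
    own other : Fin n → ℤ
    own   v = + 2 ℤ.* 𝟙 (not (cross u v)) ℤ.+ ℤ.- + 2 ℤ.* 𝟙 ⌊ u ≟ v ⌋
    other v = + 3 ℤ.* 𝟙 (cross u v) ℤ.+ ℤ.- + 2 ℤ.* 𝟙 (adj G u v)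
    sum-own : sum own ≡ + 2 ℤ.* + m ℤ.- + 2
    sum-own rewrite sum-𝟙-combination (+ 2) (ℤ.- + 2) (not ∘ cross u) (λ v → ⌊ u ≟ v ⌋)
                  | count-not-cross u | count-≟ u = refl
    sum-other : sum other ≡ + 3 ℤ.* + m ℤ.- + 2 ℤ.* + d
    sum-other rewrite sum-𝟙-combination (+ 3) (ℤ.- + 2) (cross u) (adj G u)
                    | count-cross u | regular u =
      cong (λ t → + 3 ℤ.* + m ℤ.+ t) (sym (ℤP.neg-distribˡ-* (+ 2) (+ d)))

  constant-eigenvector : ∀ u →
    sum (λ v → + dist G u v ℤ.* + 1) ≡ (+ (5 * m) - + (2 * d) - + 2) ℤ.* + 1
  constant-eigenvector u rewrite ℤP.pos-* 5 m | ℤP.pos-* 2 d = begin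
    sum (λ v → + dist G u v ℤ.* + 1)
      ≡⟨ sum-cong-≗ (λ v → cong (+ dist G u v ℤ.*_) (if-eta (cross u v))) ⟨
    sum (λ v → + dist G u v ℤ.* (if cross u v then + 1 else + 1))
      ≡⟨ row-sum u (+ 1) (+ 1) ⟩
    (+ 2 ℤ.* + m ℤ.- + 2) ℤ.* + 1 ℤ.+ (+ 3 ℤ.* + m ℤ.- + 2 ℤ.* + d) ℤ.* + 1
      ≡⟨ eigenvalue (+ m) (+ d) ⟩
    (+ 5 ℤ.* + m ℤ.- + 2 ℤ.* + d ℤ.- + 2) ℤ.* + 1
      ∎
    where
    open ≡-Reasoning
    eigenvalue : ∀ m d → (+ 2 ℤ.* m ℤ.- + 2) ℤ.* + 1 ℤ.+ (+ 3 ℤ.* m ℤ.- + 2 ℤ.* d) ℤ.* + 1 ≡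
                         (+ 5 ℤ.* m ℤ.- + 2 ℤ.* d ℤ.- + 2) ℤ.* + 1
    eigenvalue = solve-∀

  signed-eigenvector : ∀ u →
    sum (λ v → + dist G u v ℤ.* signOf (part v)) ≡ (+ (2 * d) - + m - + 2) ℤ.* signOf (part u)
  signed-eigenvector u rewrite ℤP.pos-* 2 d = begin
    sum (λ v → + dist G u v ℤ.* signOf (part v))
      ≡⟨ sum-cong-≗ (λ v → cong (+ dist G u v ℤ.*_) (signOf-relative (part u) (part v))) ⟩
    sum (λ v → + dist G u v ℤ.* (if cross u v then ℤ.- ε else ε))
      ≡⟨ row-sum u ε (ℤ.- ε) ⟩
    (+ 2 ℤ.* + m ℤ.- + 2) ℤ.* ε ℤ.+ (+ 3 ℤ.* + m ℤ.- + 2 ℤ.* + d) ℤ.* ℤ.- ε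
      ≡⟨ eigenvalue (+ m) (+ d) ε ⟩
    (+ 2 ℤ.* + d ℤ.- + m ℤ.- + 2) ℤ.* ε
      ∎
    where
    open ≡-Reasoning
    ε : ℤ
    ε = signOf (part u)
    signOf-relative : ∀ a b → signOf b ≡ (if a xor b then ℤ.- signOf a else signOf a)
    signOf-relative false false = refl
    signOf-relative false true  = refl
    signOf-relative true  false = refl
    signOf-relative true  true  = refl
    eigenvalue : ∀ m d e → (+ 2 ℤ.* m ℤ.- + 2) ℤ.* e ℤ.+ (+ 3 ℤ.* m ℤ.- + 2 ℤ.* d) ℤ.* ℤ.- e ≡
                           (+ 2 ℤ.* d ℤ.- m ℤ.- + 2) ℤ.* e
    eigenvalue = solve-∀

  -- Excluding K_{m,m} is needed only here: it forces the vertex set to be nonempty.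
  vertex : Fin n
  vertex = ¬∀⇒Fin notComplete

proposition2p1 : ∀ {n : ℕ} (G : Graph n) (part : Fin n → Bool) (m d c : ℕ) →
    IsDesignGraph G part m d c → Connected G →
    IsDistanceEigenvalue G (+ (5 * m) - + (2 * d) - + 2) ×
    IsDistanceEigenvalue G (+ (2 * d) - + m - + 2)
proposition2p1 {n} G part m d c DG conn =
    integer-eigenvector distance (+ (5 * m) - + (2 * d) - + 2) (λ _ → + 1)
      (vertex , λ ()) constant-eigenvector
  , integer-eigenvector distance (+ (2 * d) - + m - + 2) (signOf ∘ part)
      (vertex , signOf≢0 (part vertex)) signed-eigenvector
  where
  open DesignGraph DG conn
  distance : Fin n → Fin n → ℤ
  distance u v = + dist G u v
  signOf≢0 : ∀ b → signOf b ≢ + 0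
  signOf≢0 false ()
  signOf≢0 true  ()
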